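{- Let $k\ge 2$, and suppose the torus $C\,\square\,C'$ allows the $k$-wiggle decomposition, with cycles $C_1,\dots,C_k$. Suppose $S'\subseteq V(C')$ is such that $(C',S')$ is distance regular. Then there are sets $S_1,\dots,S_k$, all of the same cardinality, partitioning $V(C)\times S'$, such that for each $1\le \ell\le k$, $S_\ell\subseteq V(C_\ell)$ and $(C_\ell,S_\ell)$ is distance regular.
   Context: Cartesian product $G\,\square\,H$: vertex set $V(G)\times V(H)$, $(u,v)(u',v')$ an edge iff ($u=u'$, $vv'\in E(H)$) or ($v=v'$, $uu'\in E(G)$). A torus is $C\,\square\,C'$ for cycles $C,C'$. It allows the $k$-wiggle decomposition if, writing $C=(0,1,\dots,N-1,0)$ and $C'=(0,1,\dots,M-1,0)$, $k\mid N$ and $M=2s+k$ for an integer $s\ge0$. The $k$-wiggle decomposition consists of cycles $C_1,\dots,C_k$, where $E(C_\ell)$ is the union of: $\{(i,j)(i+1,j): 0\le j\le M-k-1,\ i\equiv \ell \pmod k\}$; $\{(i,j)(i+1,j): 0\le p\le k-1,\ i\equiv \ell+p\pmod k,\ j=M-k+p\}$; $\{(i,j)(i,j+1): i\equiv\ell\pmod k,\ 0\le j\le M-k-1,\ j\text{ odd}\}$; $\{(i,j)(i,j+1): i\equiv \ell+1\pmod k,\ 0\le j\le M-k-1,\ j\text{ even}\}$; $\{(i,j)(i,j+1): 0\le p\le k-1,\ j=M-k+p,\ i\equiv \ell+p+1\pmod k\}$ (first coordinates mod $N$, second mod $M$). A pair $(C,S)$, $C$ a cycle, $S\subseteq V(C)$,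 is distance regular if, traversing $C$ in a fixed direction, all paths between consecutive elements of $S$ have the same length. -}

module Defs where

open import Data.Nat using (ℕ; zero; suc; _+_; _*_; _∸_; _<_; _≤_; _%_)
open import Data.Nat.DivMod using (_mod_)
open import Data.Fin using (Fin; toℕ)
open import Data.Bool using (Bool; true; false)
open import Data.List using (List; length; filter; allFin; cartesianProduct)
open import Data.Product using (Σ; ∃; _×_; _,_; proj₁; proj₂)
open import Data.Sum using (_⊎_)
open import Relation.Nullary using (¬_)
open import Relation.Binary.PropositionalEquality using (_≡_)
open import Function.Definitions using (Injective)
open import Data.Bool.Properties using () renaming (_≟_ to _≟B_)

-- Vertices of the torus C □ C' with C = (0,…,N-1,0), C' = (0,…,M-1,0).
Vtx : ℕ → ℕ → Set
Vtx N M = Fin N × Fin M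

shift : {n : ℕ} → Fin n → ℕ → Fin n
shift {zero} () d
shift {suc n} t d = (toℕ t + d) mod (suc n)

next : {n : ℕ} → Fin n → Fin n
next t = shift t 1

Cong : ℕ → ℕ → ℕ → Set
Cong zero a b = a ≡ b
Cong (suc k) a b = a % suc k ≡ b % suc k

-- Conditions from the definition of the k-wiggle decomposition,
-- (i , j) the first/second coordinates, ℓ the cycle index.
-- "horizontal" edge (i,j)(i+1,j) of C_ℓ:
HCond : (M k ℓ i j : ℕ) → Set
HCond M k ℓ i j =
  (j + k < M × Cong k i ℓ)
  ⊎ (∃ λ p → p < k × j ≡ (M ∸ k) + p × Cong k i (ℓ + p))

-- "vertical" edge (i,j)(i,j+1) of C_ℓ:
VCond : (M k ℓ i j : ℕ) → Set
VCond M k ℓ i j =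
  (j + k < M × ((Cong k i ℓ × j % 2 ≡ 1) ⊎ (Cong k i (ℓ + 1) × j % 2 ≡ 0)))
  ⊎ (∃ λ p → p < k × j ≡ (M ∸ k) + p × Cong k i (ℓ + p + 1))

WStep : (N M k ℓ : ℕ) → Vtx N M → Vtx N M → Set
WStep N M k ℓ (i , j) v =
  (HCond M k ℓ (toℕ i) (toℕ j) × v ≡ (next i , j))
  ⊎ (VCond M k ℓ (toℕ i) (toℕ j) × v ≡ (i , next j))

WEdge : (N M k ℓ : ℕ) → Vtx N M → Vtx N M → Set
WEdge N M k ℓ u v = WStep N M k ℓ u v ⊎ WStep N M k ℓ v u

-- A cyclic traversal f(0) f(1) … f(L-1) f(0) of a cycle whose edge set is
-- given by the (symmetric) relation E: at least 3 vertices, no repeated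
-- vertex, consecutive vertices adjacent, and every edge of E is traversed.
IsTraversal : {V : Set} → (V → V → Set) → (L : ℕ) → (Fin L → V) → Set
IsTraversal {V} E L f =
  3 ≤ L × Injective _≡_ _≡_ f × (∀ t → E (f t) (f (next t)))
  × (∀ u v → E u v → ∃ λ t → (f t ≡ u × f (next t) ≡ v) ⊎ (f t ≡ v × f (next t) ≡ u))

-- Distance regularity of (C , S) where C is traversed as f(0) f(1) … f(L-1) f(0):
-- there is a common length d ≥ 1 such that from every element of S the next
-- element of S along the traversal is exactly d steps ahead.
DistReg : {V : Set} (L : ℕ) → (Fin L → V) → (V → Bool) → Set
DistReg L f S =
  ∃ λ d → 1 ≤ d ×
    (∀ t → S (f t) ≡ true →
      S (f (shift t d)) ≡ true × (∀ e → 1 ≤ e → e < d → ¬ (S (f (shift t e)) ≡ true)))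

card : {N M : ℕ} → (Vtx N M → Bool) → ℕ
card {N} {M} S = length (filter (λ v → S v ≟B true) (cartesianProduct (allFin N) (allFin M)))

module Submission where

-- Proposition 6.  Write K = k, N = n·K, M = 2s + K.  The wiggle cycle C_c (c = ℓ + 1) is
-- traversed in n passes; pass q climbs through all M rows, visiting in row j the two
-- horizontally adjacent vertices in columns c + K·q + offset j b (b = 0, then b = 1) and
-- stepping vertically to the next row.  The offsets are 0,1 on even low rows j < 2s, 1,0
-- on odd low rows and p,p+1 on the top row 2s + p, so a pass ends at offset K and the
-- next one starts K columns further right.  Position b + 2j + 2M·q of the traversal is
-- the b-th vertex of row j in pass q.

open import Defs
open import Data.Nat using (ℕ; suc; _+_; _*_; _≤_)
open import Data.Nat.Divisibility using (_∣_)
open import Data.Fin using (Fin; toℕ)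
open import Data.Bool using (Bool; true)
open import Data.Product using (Σ; ∃; _×_; _,_; proj₁; proj₂)
open import Function using (id)
open import Relation.Binary.PropositionalEquality using (_≡_)

open import Data.Nat.Base using (zero; _∸_; _<_; _%_; _/_; z≤n; s≤s; z<s; NonZero)
open import Data.Nat.Properties
open import Data.Nat.DivMod
open import Data.Nat.Divisibility using (divides)
open import Data.Nat.Tactic.RingSolver using (solve-∀)
open import Data.Fin.Properties using (toℕ-fromℕ<; toℕ-injective; toℕ<n)
open import Data.Bool.Base using (false; _∧_)
open import Data.Bool.Properties using (∧-zeroʳ; ∧-identityʳ) renaming (_≟_ to _≟B_)
open import Data.Sum.Base using (_⊎_; inj₁; inj₂)
open import Data.Empty using (⊥-elim)
open import Data.List.Base using (List; []; _∷_; length; filter; allFin; cartesianProduct; map)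
open import Data.List.Properties using (filter-≐)
open import Data.List.Relation.Unary.Unique.Propositional using (Unique)
open import Data.List.Relation.Unary.Unique.Propositional.Properties
  using (cartesianProduct⁺; allFin⁺) renaming (map⁺ to unique-map⁺)
open import Data.List.Membership.Propositional using (_∈_)
open import Data.List.Membership.Propositional.Properties
  using (∈-allFin; ∈-cartesianProduct⁺; ∈-map⁺)
open import Data.List.Membership.Propositional.Properties.WithK using (unique∧set⇒bag)
open import Data.List.Relation.Binary.BagAndSetEquality using (∼bag⇒↭)
open import Data.List.Relation.Binary.Permutation.Propositional using (_↭_; ↭-sym)
open import Data.List.Relation.Binary.Permutation.Propositional.Properties
  using (filter-↭; ↭-length)
open import Function.Bundles using (mk⇔)
open import Relation.Nullary using (¬_; Dec; yes; no; does)
open import Relation.Nullary.Decidable using (dec-true; dec-false; does-⇔)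
open import Relation.Binary.PropositionalEquality
  using (refl; sym; trans; cong; cong₂; subst; subst₂; _≢_; module ≡-Reasoning)

%-unique : ∀ d .{{_ : NonZero d}} {x r} q → r < d → x ≡ r + q * d → x % d ≡ r
%-unique d {r = r} q r<d refl = trans ([m+kn]%n≡m%n r q d) (m<n⇒m%n≡m r<d)

quot-rem-unique : ∀ d .{{_ : NonZero d}} {r r' q q'} → r < d → r' < d →
  r + q * d ≡ r' + q' * d → r ≡ r' × q ≡ q'
quot-rem-unique d {r} {r'} {q} {q'} r<d r'<d e =
  r≡r' , *-cancelʳ-≡ q q' d (+-cancelˡ-≡ r _ _ (trans e (cong (_+ q' * d) (sym r≡r'))))
  where
  r≡r' : r ≡ r'
  r≡r' = trans (sym (%-unique d q r<d refl)) (trans (cong (_% d) e) (%-unique d q' r'<d refl))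

%-absorbʳ : ∀ d .{{_ : NonZero d}} a b → (a + b % d) % d ≡ (a + b) % d
%-absorbʳ d a b = begin
    (a + b % d) % d         ≡⟨ %-distribˡ-+ a (b % d) d ⟩
    (a % d + b % d % d) % d ≡⟨ cong (λ z → (a % d + z) % d) (m%n%n≡m%n b d) ⟩
    (a % d + b % d) % d     ≡⟨ %-distribˡ-+ a b d ⟨
    (a + b) % d             ∎
  where open ≡-Reasoning

%-absorbˡ : ∀ d .{{_ : NonZero d}} a b → (a % d + b) % d ≡ (a + b) % d
%-absorbˡ d a b = begin
    (a % d + b) % d ≡⟨ cong (_% d) (+-comm (a % d) b) ⟩
    (b + a % d) % d ≡⟨ %-absorbʳ d b a ⟩
    (b + a) % d     ≡⟨ cong (_% d) (+-comm b a) ⟩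
    (a + b) % d     ∎
  where open ≡-Reasoning

%-cong-+ʳ : ∀ d .{{_ : NonZero d}} a b x → a % d ≡ b % d → (a + x) % d ≡ (b + x) % d
%-cong-+ʳ d a b x e = begin
  (a + x) % d     ≡⟨ %-absorbˡ d a x ⟨
  (a % d + x) % d ≡⟨ cong (λ z → (z + x) % d) e ⟩
  (b % d + x) % d ≡⟨ %-absorbˡ d b x ⟩
  (b + x) % d     ∎
  where open ≡-Reasoning

-- … and adding the same number can be cancelled (add x·(d-1) to get back to a, b).
%-cancel-+ʳ : ∀ d' a b x → (a + x) % suc d' ≡ (b + x) % suc d' → a % suc d' ≡ b % suc d'
%-cancel-+ʳ d' a b x e = trans (sym (back a)) (trans (%-cong-+ʳ (suc d') (a + x) (b + x) (x * d') e) (back b))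
  where
  back : ∀ a → (a + x + x * d') % suc d' ≡ a % suc d'
  back a = trans (cong (_% suc d') (trans (+-assoc a x (x * d')) (cong (a +_) (sym (*-suc x d')))))
                 ([m+kn]%n≡m%n a x (suc d'))

%-cancel-+ˡ : ∀ d' x a b → (x + a) % suc d' ≡ (x + b) % suc d' → a % suc d' ≡ b % suc d'
%-cancel-+ˡ d' x a b e =
  %-cancel-+ʳ d' a b x (trans (cong (_% suc d') (+-comm a x)) (trans e (cong (_% suc d') (+-comm x b))))

suc-%-≢ : ∀ d' x → suc x % suc (suc d') ≢ x % suc (suc d')
suc-%-≢ d' x e with %-cancel-+ʳ (suc d') 1 0 x e
... | ()

*-%-cancelʳ : ∀ n K .{{_ : NonZero n}} .{{_ : NonZero K}} .{{_ : NonZero (n * K)}} q q' →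
  (q * K) % (n * K) ≡ (q' * K) % (n * K) → q % n ≡ q' % n
*-%-cancelʳ n K q q' e =
  *-cancelʳ-≡ (q % n) (q' % n) K (trans (m%n*o≡m*o%[n*o] q n K) (trans e (sym (m%n*o≡m*o%[n*o] q' n K))))

parity : ∀ j → j % 2 ≡ 0 ⊎ j % 2 ≡ 1
parity j with j % 2 | m%n<n j 2
... | 0 | _ = inj₁ refl
... | 1 | _ = inj₂ refl
... | suc (suc _) | s≤s (s≤s ())

even⇒suc-odd : ∀ j → j % 2 ≡ 0 → suc j % 2 ≡ 1
even⇒suc-odd j e = %-unique 2 (j / 2) (s≤s (s≤s z≤n))
  (cong suc (trans (m≡m%n+[m/n]*n j 2) (cong (_+ (j / 2) * 2) e)))

odd⇒suc-even : ∀ j → j % 2 ≡ 1 → suc j % 2 ≡ 0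
odd⇒suc-even j e = %-unique 2 (suc (j / 2)) z<s
  (cong suc (trans (m≡m%n+[m/n]*n j 2) (cong (_+ (j / 2) * 2) e)))

2*-even : ∀ s → (2 * s) % 2 ≡ 0
2*-even s = %-unique 2 s z<s (*-comm 2 s)

toℕ-mod : ∀ {m} x → toℕ (x mod suc m) ≡ x % suc m
toℕ-mod x = toℕ-fromℕ< _

toℕ-shift : ∀ {m} (t : Fin (suc m)) d → toℕ (shift t d) ≡ (toℕ t + d) % suc m
toℕ-shift t d = toℕ-fromℕ< _

mod-cong : ∀ {m} x y → x % suc m ≡ y % suc m → x mod suc m ≡ y mod suc m
mod-cong {m} x y e = toℕ-injective (trans (toℕ-mod x) (trans e (sym (toℕ-mod y))))

next-mod : ∀ {m} x → next (x mod suc m) ≡ suc x mod suc m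
next-mod {m} x = toℕ-injective (begin
    toℕ (next (x mod suc m))     ≡⟨ toℕ-shift (x mod suc m) 1 ⟩
    (toℕ (x mod suc m) + 1) % suc m ≡⟨ cong (λ z → (z + 1) % suc m) (toℕ-mod x) ⟩
    (x % suc m + 1) % suc m      ≡⟨ %-absorbˡ (suc m) x 1 ⟩
    (x + 1) % suc m              ≡⟨ cong (_% suc m) (+-comm x 1) ⟩
    suc x % suc m                ≡⟨ toℕ-mod (suc x) ⟨
    toℕ (suc x mod suc m)        ∎)
  where open ≡-Reasoning

%-solve : ∀ m' a y → ∃ λ (ℓ : Fin (suc m')) → (toℕ ℓ + y) % suc m' ≡ a % suc m'
%-solve m' a y = ℓ , (begin
    (toℕ ℓ + y) % m              ≡⟨ cong (λ z → (z + y) % m) (toℕ-mod {m'} (a + m' * y)) ⟩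
    ((a + m' * y) % m + y) % m   ≡⟨ %-absorbˡ m (a + m' * y) y ⟩
    (a + m' * y + y) % m         ≡⟨ cong (_% m) (regroup a m' y) ⟩
    (a + y * m) % m              ≡⟨ [m+kn]%n≡m%n a y m ⟩
    a % m                        ∎)
  where
  open ≡-Reasoning
  m = suc m'
  ℓ = (a + m' * y) mod m
  regroup : ∀ a m' y → a + m' * y + y ≡ a + y * suc m'
  regroup = solve-∀

%-solve-unique : ∀ m' y (ℓ ℓ' : Fin (suc m')) → (toℕ ℓ + y) % suc m' ≡ (toℕ ℓ' + y) % suc m' → ℓ ≡ ℓ'
%-solve-unique m' y ℓ ℓ' e = toℕ-injective (begin
    toℕ ℓ           ≡⟨ m<n⇒m%n≡m (toℕ<n ℓ) ⟨
    toℕ ℓ % suc m'  ≡⟨ %-cancel-+ʳ m' (toℕ ℓ) (toℕ ℓ') y e ⟩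
    toℕ ℓ' % suc m' ≡⟨ m<n⇒m%n≡m (toℕ<n ℓ') ⟩
    toℕ ℓ'          ∎)
  where open ≡-Reasoning

shift-shift : ∀ {m} (i : Fin (suc m)) a b → a + b ≡ suc m → shift (shift i a) b ≡ i
shift-shift {m} i a b e = toℕ-injective (begin
    toℕ (shift (shift i a) b)      ≡⟨ toℕ-shift (shift i a) b ⟩
    (toℕ (shift i a) + b) % suc m  ≡⟨ cong (λ z → (z + b) % suc m) (toℕ-shift i a) ⟩
    ((toℕ i + a) % suc m + b) % suc m ≡⟨ %-absorbˡ (suc m) (toℕ i + a) b ⟩
    (toℕ i + a + b) % suc m        ≡⟨ cong (_% suc m) (trans (+-assoc (toℕ i) a b) (cong (toℕ i +_) e)) ⟩
    (toℕ i + suc m) % suc m        ≡⟨ [m+n]%n≡m%n (toℕ i) (suc m) ⟩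
    toℕ i % suc m                  ≡⟨ m<n⇒m%n≡m (toℕ<n i) ⟩
    toℕ i                          ∎)
  where open ≡-Reasoning

module _ {N M : ℕ} where

  vertices : List (Vtx N M)
  vertices = cartesianProduct (allFin N) (allFin M)

  vertices-unique : Unique vertices
  vertices-unique = cartesianProduct⁺ (allFin⁺ N) (allFin⁺ M)

  ∈-vertices : ∀ v → v ∈ vertices
  ∈-vertices (i , j) = ∈-cartesianProduct⁺ (∈-allFin i) (∈-allFin j)

  private
    length-filter-map : ∀ (S : Vtx N M → Bool) (σ : Vtx N M → Vtx N M) xs →
      length (filter (λ v → S v ≟B true) (map σ xs)) ≡ length (filter (λ v → S (σ v) ≟B true) xs)
    length-filter-map S σ [] = refl
    length-filter-map S σ (x ∷ xs) with S (σ x) ≟B true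
    ... | yes _ = cong suc (length-filter-map S σ xs)
    ... | no _ = length-filter-map S σ xs

  card-cong : ∀ (S S₂ : Vtx N M → Bool) → (∀ v → S v ≡ S₂ v) → card S ≡ card S₂
  card-cong S S₂ S≗S₂ = cong length (filter-≐ (λ v → S v ≟B true) (λ v → S₂ v ≟B true)
    ((λ {v} e → trans (sym (S≗S₂ v)) e) , (λ {v} e → trans (S≗S₂ v) e)) vertices)

  card-∘-bijection : ∀ (S : Vtx N M → Bool) (σ τ : Vtx N M → Vtx N M) →
    (∀ v → τ (σ v) ≡ v) → (∀ v → σ (τ v) ≡ v) → card S ≡ card (λ v → S (σ v))
  card-∘-bijection S σ τ τσ στ =
    trans (↭-length (filter-↭ (λ v → S v ≟B true) (↭-sym σ-permutes))) (length-filter-map S σ vertices)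
    where
    σ-injective : ∀ {x y} → σ x ≡ σ y → x ≡ y
    σ-injective {x} {y} e = trans (sym (τσ x)) (trans (cong τ e) (τσ y))
    σ-permutes : map σ vertices ↭ vertices
    σ-permutes = ∼bag⇒↭ (unique∧set⇒bag (unique-map⁺ σ-injective vertices-unique) vertices-unique
      (λ {x} → mk⇔ (λ _ → ∈-vertices x)
                   (λ _ → subst (_∈ map σ vertices) (στ x) (∈-map⁺ σ (∈-vertices (τ x))))))

∧-true : ∀ {a b} → a ∧ b ≡ true → a ≡ true × b ≡ true
∧-true {true} {true} _ = refl , refl

does-true : ∀ {A : Set} (a? : Dec A) → does a? ≡ true → A
does-true (yes a) _ = a

module Wiggle (k' s n' : ℕ) {M' : ℕ} (M≡ : suc M' ≡ 2 * s + suc (suc k')) where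

  K : ℕ
  K = suc (suc k')

  M : ℕ
  M = suc M'

  n : ℕ
  n = suc n'

  -- the torus has N = n·K columns and M rows; each wiggle cycle has L = n·2M vertices
  N : ℕ
  N = n * K

  L : ℕ
  L = n * (2 * M)

  -- A row j is low when j < 2s (equivalently j + K < M) and a top row 2s + p, p < K,
  -- otherwise; these are the two kinds of rows in the definition of the decomposition.
  low⇒+K< : ∀ {j} → j < 2 * s → j + K < M
  low⇒+K< {j} h = subst (j + K <_) (sym M≡) (+-monoˡ-< K h)

  +K<⇒low : ∀ {j} → j + K < M → j < 2 * s
  +K<⇒low {j} h = +-cancelʳ-< K j (2 * s) (subst (j + K <_) M≡ h)

  M∸K≡2s : M ∸ K ≡ 2 * s
  M∸K≡2s = trans (cong (_∸ K) M≡) (m+n∸n≡m (2 * s) K)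

  top-row : ∀ {j} → j < M → 2 * s ≤ j → (j ∸ 2 * s) < K × j ≡ (M ∸ K) + (j ∸ 2 * s)
  top-row {j} j<M 2s≤j =
    +-cancelˡ-< (2 * s) (j ∸ 2 * s) K (subst₂ _<_ j≡ M≡ j<M) , trans j≡ (cong (_+ (j ∸ 2 * s)) (sym M∸K≡2s))
    where
    j≡ : j ≡ 2 * s + (j ∸ 2 * s)
    j≡ = sym (m+[n∸m]≡n 2s≤j)

  top-row⁻¹ : ∀ {j p} → j ≡ (M ∸ K) + p → 2 * s ≤ j × j ∸ 2 * s ≡ p
  top-row⁻¹ {j} {p} j≡ = subst (2 * s ≤_) (sym j≡') (m≤m+n (2 * s) p) ,
                         trans (cong (_∸ 2 * s) j≡') (m+n∸m≡n (2 * s) p)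
    where
    j≡' : j ≡ 2 * s + p
    j≡' = trans j≡ (cong (_+ p) M∸K≡2s)

  data RowKind (j : ℕ) : Set where
    low-even : j < 2 * s → j % 2 ≡ 0 → RowKind j
    low-odd  : j < 2 * s → j % 2 ≡ 1 → RowKind j
    top      : 2 * s ≤ j → RowKind j

  rowKind : ∀ j → RowKind j
  rowKind j with j <? 2 * s | parity j
  ... | yes h | inj₁ e = low-even h e
  ... | yes h | inj₂ e = low-odd h e
  ... | no h  | _      = top (≮⇒≥ h)

  -- One pass of the wiggle cycle visits two horizontally adjacent vertices in each row j,
  -- at column offsets `offset j 0` and then `offset j 1`: the offsets are 0,1 on even low
  -- rows, 1,0 on odd low rows and p,p+1 on the top row 2s + p.
  offsetOf : ∀ {j} → RowKind j → ℕ → ℕ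
  offsetOf (low-even _ _) b = b
  offsetOf (low-odd _ _)  b = 1 ∸ b
  offsetOf {j} (top _)    b = (j ∸ 2 * s) + b

  offset : ℕ → ℕ → ℕ
  offset j = offsetOf (rowKind j)

  offset-low-even : ∀ {j} b → j < 2 * s → j % 2 ≡ 0 → offset j b ≡ b
  offset-low-even {j} b h e with rowKind j
  ... | low-even _ _ = refl
  ... | low-odd _ e' = ⊥-elim (0≢1+n (trans (sym e) e'))
  ... | top h'       = ⊥-elim (<⇒≱ h h')

  offset-low-odd : ∀ {j} b → j < 2 * s → j % 2 ≡ 1 → offset j b ≡ 1 ∸ b
  offset-low-odd {j} b h e with rowKind j
  ... | low-even _ e' = ⊥-elim (0≢1+n (trans (sym e') e))
  ... | low-odd _ _   = refl
  ... | top h'        = ⊥-elim (<⇒≱ h h')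

  offset-top : ∀ {j} b → 2 * s ≤ j → offset j b ≡ (j ∸ 2 * s) + b
  offset-top {j} b h with rowKind j
  ... | low-even h' _ = ⊥-elim (<⇒≱ h' h)
  ... | low-odd h' _  = ⊥-elim (<⇒≱ h' h)
  ... | top _         = refl

  offsets-adjacent : ∀ j → offset j 1 ≡ suc (offset j 0) ⊎ offset j 0 ≡ suc (offset j 1)
  offsets-adjacent j with rowKind j
  ... | low-even _ _ = inj₁ refl
  ... | low-odd _ _  = inj₂ refl
  ... | top _        = inj₁ (+-suc (j ∸ 2 * s) 0)

  offset-start : offset 0 0 ≡ 0
  offset-start with rowKind 0
  ... | low-even _ _ = refl
  ... | low-odd _ ()
  ... | top _        = trans (+-identityʳ _) (0∸n≡0 (2 * s))

  offset-up : ∀ j → suc j < M → offset (suc j) 0 ≡ offset j 1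
  offset-up j _ with rowKind j
  ... | low-even h e with m≤n⇒m<n∨m≡n h
  ...   | inj₁ sj<2s = offset-low-odd 0 sj<2s (even⇒suc-odd j e)
  ...   | inj₂ sj≡2s = ⊥-elim (0≢1+n (trans (sym (2*-even s)) (trans (cong (_% 2) (sym sj≡2s)) (even⇒suc-odd j e))))
  offset-up j _ | low-odd h e with m≤n⇒m<n∨m≡n h
  ...   | inj₁ sj<2s = offset-low-even 0 sj<2s (odd⇒suc-even j e)
  ...   | inj₂ sj≡2s = trans (offset-top 0 (≤-reflexive (sym sj≡2s)))
                         (trans (+-identityʳ _) (trans (cong (_∸ 2 * s) sj≡2s) (n∸n≡0 (2 * s))))
  offset-up j _ | top h =
    trans (offset-top 0 (m≤n⇒m≤1+n h))
          (trans (+-identityʳ _) (trans (cong (_∸ 2 * s) (+-comm 1 j)) (+-∸-comm 1 h)))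

  offset-end : ∀ j → suc j ≡ M → offset j 1 ≡ K
  offset-end j sj≡M = trans (offset-top 1 2s≤j)
    (trans (sym (+-∸-comm 1 2s≤j)) (trans (cong (_∸ 2 * s) (trans (+-comm j 1) (trans sj≡M M≡))) (m+n∸m≡n (2 * s) K)))
    where
    2s≤j : 2 * s ≤ j
    2s≤j = subst (2 * s ≤_) (sym (suc-injective (trans sj≡M (trans M≡ (+-suc (2 * s) (suc k'))))))
                 (m≤m+n (2 * s) (suc k'))

  Triple : Set
  Triple = ℕ × ℕ × ℕ

  index : ℕ → ℕ → ℕ → ℕ
  index q j b = (b + j * 2) + q * (2 * M)

  decode : ℕ → Triple
  decode t = t / (2 * M) , (t % (2 * M)) / 2 , (t % (2 * M)) % 2

  Valid : Triple → Set
  Valid (q , j , b) = j < M × b < 2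

  decode-valid : ∀ t → Valid (decode t)
  decode-valid t =
    m<n*o⇒m/o<n (subst (t % (2 * M) <_) (*-comm 2 M) (m%n<n t (2 * M))) , m%n<n (t % (2 * M)) 2

  index-decode : ∀ t → let (q , j , b) = decode t in t ≡ index q j b
  index-decode t = trans (m≡m%n+[m/n]*n t (2 * M))
                         (cong (_+ (t / (2 * M)) * (2 * M)) (m≡m%n+[m/n]*n (t % (2 * M)) 2))

  within-pass : ∀ {j b} → j < M → b < 2 → b + j * 2 < 2 * M
  within-pass {j} {b} j<M b<2 = begin-strict
      b + j * 2 <⟨ +-monoˡ-< (j * 2) b<2 ⟩
      2 + j * 2 ≡⟨ *-comm (suc j) 2 ⟩
      2 * suc j ≤⟨ *-monoʳ-≤ 2 j<M ⟩
      2 * M     ∎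
    where open ≤-Reasoning

  index-injective : ∀ {q j b q' j' b'} → Valid (q , j , b) → Valid (q' , j' , b') →
    index q j b ≡ index q' j' b' → (q , j , b) ≡ (q' , j' , b')
  index-injective {q} {j} {b} {q'} {j'} {b'} (j<M , b<2) (j'<M , b'<2) e
    with quot-rem-unique (2 * M) {q = q} {q' = q'} (within-pass j<M b<2) (within-pass j'<M b'<2) e
  ... | rest≡ , refl with quot-rem-unique 2 {q = j} {q' = j'} b<2 b'<2 rest≡
  ...   | refl , refl = refl

  decode-index : ∀ q j b → Valid (q , j , b) → decode (index q j b) ≡ (q , j , b)
  decode-index q j b v = index-injective (decode-valid (index q j b)) v (sym (index-decode (index q j b)))

  column : ℕ → Triple → ℕ
  column c (q , j , b) = (c + offset j b) + K * q

  vertex : ℕ → Triple → Vtx N M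
  vertex c p = (column c p mod N , proj₁ (proj₂ p) mod M)

  visit : ℕ → ℕ → Vtx N M
  visit c t = vertex c (decode t)

  walk : ℕ → Fin L → Vtx N M
  walk c t = visit c (toℕ t)

  visit-period : ∀ c m t → visit c (t + m * L) ≡ visit c t
  visit-period c m t = begin
      visit c (t + m * L)               ≡⟨ cong (visit c) t+mL ⟩
      visit c (index (q + m * n) j b)   ≡⟨ cong (vertex c) (decode-index (q + m * n) j b (decode-valid t)) ⟩
      vertex c (q + m * n , j , b)      ≡⟨ cong (_, j mod M) same-column ⟩
      vertex c (q , j , b)              ∎
    where
    open ≡-Reasoning
    q = proj₁ (decode t)
    j = proj₁ (proj₂ (decode t))
    b = proj₂ (proj₂ (decode t))
    t+mL : t + m * L ≡ index (q + m * n) j b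
    t+mL = trans (cong (_+ m * L) (index-decode t)) (idx (b + j * 2) q m n (2 * M))
      where
      idx : ∀ r q m n P → r + q * P + m * (n * P) ≡ r + (q + m * n) * P
      idx = solve-∀
    same-column : column c (q + m * n , j , b) mod N ≡ column c (q , j , b) mod N
    same-column = mod-cong (column c (q + m * n , j , b)) (column c (q , j , b))
      (trans (cong (_% N) (col (c + offset j b) K q m n)) ([m+kn]%n≡m%n (column c (q , j , b)) m N))
      where
      col : ∀ x K q m n → x + K * (q + m * n) ≡ (x + K * q) + m * (n * K)
      col = solve-∀

  visit-mod : ∀ c t → visit c (t % L) ≡ visit c t
  visit-mod c t = trans (sym (visit-period c (t / L) (t % L))) (cong (visit c) (sym (m≡m%n+[m/n]*n t L)))

  walk-shift : ∀ c (t : Fin L) e → walk c (shift t e) ≡ visit c (toℕ t + e)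
  walk-shift c t e = trans (cong (visit c) (toℕ-shift t e)) (visit-mod c (toℕ t + e))

  right : Vtx N M → Vtx N M
  right (i , j) = (next i , j)

  up : Vtx N M → Vtx N M
  up (i , j) = (i , next j)

  toℕ-row : ∀ {j} → j < M → toℕ (j mod M) ≡ j
  toℕ-row {j} j<M = trans (toℕ-mod j) (m<n⇒m%n≡m j<M)

  row-low : ∀ {j} → j < M → j < 2 * s → toℕ (j mod M) + K < M
  row-low j<M h = subst (λ z → z + K < M) (sym (toℕ-row j<M)) (low⇒+K< h)

  row-top : ∀ {j} → j < M → 2 * s ≤ j → toℕ (j mod M) ≡ (M ∸ K) + (j ∸ 2 * s)
  row-top j<M h = trans (toℕ-row j<M) (proj₂ (top-row j<M h))

  row-parity : ∀ {j} → j < M → toℕ (j mod M) % 2 ≡ j % 2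
  row-parity j<M = cong (_% 2) (toℕ-row j<M)

  -- Modulo K, the column of a vertex only depends on the cycle index and its offset
  -- (N is a multiple of K and passes are K columns apart).
  column-residue : ∀ c q j b → toℕ (proj₁ (vertex c (q , j , b))) % K ≡ (c + offset j b) % K
  column-residue c q j b = begin
      toℕ (proj₁ (vertex c (q , j , b))) % K ≡⟨ cong (_% K) (toℕ-mod (column c (q , j , b))) ⟩
      column c (q , j , b) % N % K           ≡⟨ m∣n⇒o%n%m≡o%m K N (column c (q , j , b)) (divides n refl) ⟩
      ((c + offset j b) + K * q) % K         ≡⟨ cong (λ z → ((c + offset j b) + z) % K) (*-comm K q) ⟩
      ((c + offset j b) + q * K) % K         ≡⟨ [m+kn]%n≡m%n (c + offset j b) q K ⟩
      (c + offset j b) % K                   ∎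
    where open ≡-Reasoning

  residue : ∀ c q j b {x} → c + offset j b ≡ x → Cong K (toℕ (proj₁ (vertex c (q , j , b)))) x
  residue c q j b e = trans (column-residue c q j b) (cong (_% K) e)

  vertex-right : ∀ c q j {b b'} → offset j b' ≡ suc (offset j b) →
    vertex c (q , j , b') ≡ right (vertex c (q , j , b))
  vertex-right c q j {b} {b'} e =
    cong (_, j mod M) (trans (cong (_mod N) (cong (_+ K * q) (trans (cong (c +_) e) (+-suc c (offset j b)))))
                             (sym (next-mod (column c (q , j , b)))))

  visit-after-first : ∀ c q j → j < M → visit c (suc (index q j 0)) ≡ vertex c (q , j , 1)
  visit-after-first c q j j<M = cong (vertex c) (decode-index q j 1 (j<M , s≤s (s≤s z≤n)))

  visit-after-second : ∀ c q j → j < M → visit c (suc (index q j 1)) ≡ up (vertex c (q , j , 1))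
  visit-after-second c q j j<M with m≤n⇒m<n∨m≡n j<M
  ... | inj₁ sj<M =
    trans (cong (vertex c) (decode-index q (suc j) 0 (sj<M , z<s)))
          (cong₂ _,_ (cong (λ z → ((c + z) + K * q) mod N) (offset-up j sj<M)) (sym (next-mod j)))
  ... | inj₂ sj≡M =
    trans (cong (visit c) next-pass)
          (trans (cong (vertex c) (decode-index (suc q) 0 0 (z<s , z<s)))
                 (cong₂ _,_ (cong (_mod N) column≡) (trans row≡ (sym (next-mod j)))))
    where
    next-pass : suc (index q j 1) ≡ index (suc q) 0 0
    next-pass = cong (_+ q * (2 * M)) (trans (cong (_* 2) sj≡M) (*-comm M 2))
    column≡ : column c (suc q , 0 , 0) ≡ column c (q , j , 1)
    column≡ = begin
        (c + offset 0 0) + K * suc q ≡⟨ cong (λ z → (c + z) + K * suc q) offset-start ⟩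
        (c + 0) + K * suc q         ≡⟨ cong₂ _+_ (+-identityʳ c) (*-suc K q) ⟩
        c + (K + K * q)             ≡⟨ +-assoc c K (K * q) ⟨
        (c + K) + K * q             ≡⟨ cong (λ z → (c + z) + K * q) (offset-end j sj≡M) ⟨
        (c + offset j 1) + K * q    ∎
      where open ≡-Reasoning
    row≡ : 0 mod M ≡ suc j mod M
    row≡ = mod-cong 0 (suc j) (trans (sym (n%n≡0 M)) (cong (_% M) (sym sj≡M)))

  private
    step : ∀ {j b b' x} → offset j b ≡ x → offset j b' ≡ suc x → offset j b' ≡ suc (offset j b)
    step e e' = trans e' (cong suc (sym e))

    c+0 : ∀ c {y} → y ≡ 0 → c + y ≡ c
    c+0 c y≡0 = trans (cong (c +_) y≡0) (+-identityʳ c)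

  -- Every step of the traversal is an edge of the wiggle cycle C_c: inside a row the step
  -- is horizontal (HCond at its left end), from the second vertex of a row it is vertical
  -- (VCond there).
  first-to-second : ∀ c q j → j < M → WEdge N M K c (vertex c (q , j , 0)) (vertex c (q , j , 1))
  first-to-second c q j j<M = by-kind (rowKind j)
    where
    by-kind : RowKind j → WEdge N M K c (vertex c (q , j , 0)) (vertex c (q , j , 1))
    by-kind (low-even h e) =
      inj₁ (inj₁ (inj₁ (row-low j<M h , residue c q j 0 (c+0 c o0)) ,
                  vertex-right c q j (step o0 o1)))
      where
      o0 = offset-low-even 0 h e
      o1 = offset-low-even 1 h e
    by-kind (low-odd h e) =
      inj₂ (inj₁ (inj₁ (row-low j<M h , residue c q j 1 (c+0 c o1)) ,
                  vertex-right c q j (step o1 o0)))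
      where
      o0 = offset-low-odd 0 h e
      o1 = offset-low-odd 1 h e
    by-kind (top h) =
      inj₁ (inj₁ (inj₂ (j ∸ 2 * s , proj₁ (top-row j<M h) , row-top j<M h ,
                        residue c q j 0 (cong (c +_) (trans o0 (+-identityʳ _)))) ,
                  vertex-right c q j (step o0 (trans o1 (+-suc _ 0)))))
      where
      o0 = offset-top 0 h
      o1 = offset-top 1 h

  second-vcond : ∀ c q j → j < M → VCond M K c (toℕ (proj₁ (vertex c (q , j , 1)))) (toℕ (j mod M))
  second-vcond c q j j<M = by-kind (rowKind j)
    where
    by-kind : RowKind j → VCond M K c (toℕ (proj₁ (vertex c (q , j , 1)))) (toℕ (j mod M))
    by-kind (low-even h e) =
      inj₁ (row-low j<M h , inj₂ (residue c q j 1 (cong (c +_) (offset-low-even 1 h e)) ,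
                                  trans (row-parity j<M) e))
    by-kind (low-odd h e) =
      inj₁ (row-low j<M h , inj₁ (residue c q j 1 (c+0 c (offset-low-odd 1 h e)) ,
                                  trans (row-parity j<M) e))
    by-kind (top h) =
      inj₂ (j ∸ 2 * s , proj₁ (top-row j<M h) , row-top j<M h ,
            residue c q j 1 (trans (cong (c +_) (offset-top 1 h)) (sym (+-assoc c _ 1))))

  visit-step : ∀ c q j b → Valid (q , j , b) →
    WEdge N M K c (vertex c (q , j , b)) (visit c (suc (index q j b)))
  visit-step c q j 0 (j<M , _) =
    subst (WEdge N M K c (vertex c (q , j , 0))) (sym (visit-after-first c q j j<M))
          (first-to-second c q j j<M)
  visit-step c q j 1 (j<M , _) =
    subst (WEdge N M K c (vertex c (q , j , 1))) (sym (visit-after-second c q j j<M))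
          (inj₁ (inj₂ (second-vcond c q j j<M , refl)))
  visit-step c q j (suc (suc _)) (_ , s≤s (s≤s ()))

  walk-next : ∀ c (t : Fin L) → walk c (next t) ≡ visit c (suc (toℕ t))
  walk-next c t = trans (walk-shift c t 1) (cong (visit c) (+-comm (toℕ t) 1))

  walk-step : ∀ c (t : Fin L) → WEdge N M K c (walk c t) (walk c (next t))
  walk-step c t = subst (WEdge N M K c (walk c t)) next≡ (visit-step c q j b (decode-valid (toℕ t)))
    where
    q = proj₁ (decode (toℕ t))
    j = proj₁ (proj₂ (decode (toℕ t)))
    b = proj₂ (proj₂ (decode (toℕ t)))
    next≡ : visit c (suc (index q j b)) ≡ walk c (next t)
    next≡ = trans (cong (λ z → visit c (suc z)) (sym (index-decode (toℕ t)))) (sym (walk-next c t))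

  pass-reaching : ∀ x (i : Fin N) → Cong K (toℕ i) x → ∃ λ q → (x + K * q) % N ≡ toℕ i
  pass-reaching x i i≡x = q , reaches
    where
    I = toℕ i
    q = I / K + x * n ∸ x / K
    x/K≤ : x / K ≤ I / K + x * n
    x/K≤ = ≤-trans (m/n≤m x K) (≤-trans (≤-trans (m≤m+n x (x * n')) (≤-reflexive (sym (*-suc x n'))))
                                         (m≤n+m (x * n) (I / K)))
    regroup₁ : ∀ r a q K → (r + a * K) + K * q ≡ r + (a + q) * K
    regroup₁ = solve-∀
    regroup₂ : ∀ r a x n K → r + (a + x * n) * K ≡ (r + a * K) + x * (n * K)
    regroup₂ = solve-∀
    x+Kq≡ : x + K * q ≡ I + x * N
    x+Kq≡ = begin
        x + K * q                             ≡⟨ cong (_+ K * q) (m≡m%n+[m/n]*n x K) ⟩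
        (x % K + (x / K) * K) + K * q         ≡⟨ regroup₁ (x % K) (x / K) q K ⟩
        x % K + (x / K + q) * K               ≡⟨ cong (λ z → x % K + z * K) (m+[n∸m]≡n x/K≤) ⟩
        x % K + (I / K + x * n) * K           ≡⟨ cong (λ z → z + (I / K + x * n) * K) (sym i≡x) ⟩
        I % K + (I / K + x * n) * K           ≡⟨ regroup₂ (I % K) (I / K) x n K ⟩
        (I % K + (I / K) * K) + x * (n * K)   ≡⟨ cong (_+ x * N) (sym (m≡m%n+[m/n]*n I K)) ⟩
        I + x * N                             ∎
      where open ≡-Reasoning
    reaches : (x + K * q) % N ≡ I
    reaches = trans (cong (_% N) x+Kq≡) (trans ([m+kn]%n≡m%n I x N) (m<n⇒m%n≡m (toℕ<n i)))

  occurs : ∀ c b (i : Fin N) (jj : Fin M) → Cong K (toℕ i) (c + offset (toℕ jj) b) →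
    ∃ λ q → vertex c (q , toℕ jj , b) ≡ (i , jj)
  occurs c b i jj i≡ with pass-reaching (c + offset (toℕ jj) b) i i≡
  ... | q , reaches = q , cong₂ _,_ (toℕ-injective (trans (toℕ-mod (column c (q , toℕ jj , b))) reaches))
                                    (toℕ-injective (toℕ-row (toℕ<n jj)))

  occurs-step : ∀ c q j b → Valid (q , j , b) →
    ∃ λ t → walk c t ≡ vertex c (q , j , b) × walk c (next t) ≡ visit c (suc (index q j b))
  occurs-step c q j b v = T mod L , here , after
    where
    T = index q j b
    t≡ : toℕ (T mod L) ≡ T % L
    t≡ = toℕ-mod T
    here : walk c (T mod L) ≡ vertex c (q , j , b)
    here = trans (cong (visit c) t≡) (trans (visit-mod c T) (cong (vertex c) (decode-index q j b v)))
    after : walk c (next (T mod L)) ≡ visit c (suc T)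
    after = begin
        walk c (next (T mod L))          ≡⟨ walk-next c (T mod L) ⟩
        visit c (suc (toℕ (T mod L)))    ≡⟨ cong (λ z → visit c (suc z)) t≡ ⟩
        visit c (suc (T % L))            ≡⟨ visit-period c (T / L) (suc (T % L)) ⟨
        visit c (suc (T % L) + T / L * L) ≡⟨ cong (λ z → visit c (suc z)) (m≡m%n+[m/n]*n T L) ⟨
        visit c (suc T)                  ∎
      where open ≡-Reasoning

  Traversed : ℕ → Vtx N M → Vtx N M → Set
  Traversed c u v = ∃ λ t → (walk c t ≡ u × walk c (next t) ≡ v) ⊎ (walk c t ≡ v × walk c (next t) ≡ u)

  traversed-rightwards : ∀ c (i : Fin N) (jj : Fin M) → let j = toℕ jj in
    Cong K (toℕ i) (c + offset j 0) → offset j 1 ≡ suc (offset j 0) → Traversed c (i , jj) (right (i , jj))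
  traversed-rightwards c i jj i≡ o-step =
    let (q , u≡) = occurs c 0 i jj i≡
        (t , here , after) = occurs-step c q (toℕ jj) 0 (toℕ<n jj , z<s)
    in t , inj₁ (trans here u≡ ,
                 trans after (trans (visit-after-first c q (toℕ jj) (toℕ<n jj))
                                    (trans (vertex-right c q (toℕ jj) o-step) (cong right u≡))))

  traversed-leftwards : ∀ c (i : Fin N) (jj : Fin M) → let j = toℕ jj in
    Cong K (toℕ i) (c + offset j 1) → offset j 0 ≡ suc (offset j 1) → Traversed c (i , jj) (right (i , jj))
  traversed-leftwards c i jj i≡ o-step =
    let (q , u≡) = occurs c 1 i jj i≡
        (t , here , after) = occurs-step c q (toℕ jj) 0 (toℕ<n jj , z<s)
    in t , inj₂ (trans here (trans (vertex-right c q (toℕ jj) o-step) (cong right u≡)) ,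
                 trans after (trans (visit-after-first c q (toℕ jj) (toℕ<n jj)) u≡))

  traversed-upwards : ∀ c (i : Fin N) (jj : Fin M) →
    Cong K (toℕ i) (c + offset (toℕ jj) 1) → Traversed c (i , jj) (up (i , jj))
  traversed-upwards c i jj i≡ =
    let (q , u≡) = occurs c 1 i jj i≡
        (t , here , after) = occurs-step c q (toℕ jj) 1 (toℕ<n jj , s≤s z<s)
    in t , inj₁ (trans here u≡ ,
                 trans after (trans (visit-after-second c q (toℕ jj) (toℕ<n jj)) (cong up u≡)))

  -- Conversely every edge of C_c is crossed by the traversal: an edge satisfying HCond or
  -- VCond at its start is one of the three kinds of crossings above.
  private
    shift-residue : ∀ c i {y z} → Cong K i (c + y) → z ≡ y → Cong K i (c + z)
    shift-residue c i i≡ z≡y = trans i≡ (cong (λ w → (c + w) % K) (sym z≡y))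

  horizontal-traversed : ∀ c (i : Fin N) (jj : Fin M) → HCond M K c (toℕ i) (toℕ jj) →
    Traversed c (i , jj) (right (i , jj))
  horizontal-traversed c i jj (inj₁ (low , i≡c)) = by-parity (parity j)
    where
    j = toℕ jj
    h = +K<⇒low low
    i≡c+0 : ∀ {y} → y ≡ 0 → Cong K (toℕ i) (c + y)
    i≡c+0 y≡0 = trans i≡c (cong (_% K) (sym (c+0 c y≡0)))
    by-parity : j % 2 ≡ 0 ⊎ j % 2 ≡ 1 → Traversed c (i , jj) (right (i , jj))
    by-parity (inj₁ e) = traversed-rightwards c i jj (i≡c+0 o0) (step o0 (offset-low-even 1 h e))
      where o0 = offset-low-even 0 h e
    by-parity (inj₂ e) = traversed-leftwards c i jj (i≡c+0 o1) (step o1 (offset-low-odd 0 h e))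
      where o1 = offset-low-odd 1 h e
  horizontal-traversed c i jj (inj₂ (p , _ , j≡ , i≡)) =
    traversed-rightwards c i jj (shift-residue c (toℕ i) i≡ o0) (step o0 o1)
    where
    j = toℕ jj
    on-top = top-row⁻¹ j≡
    o0 : offset j 0 ≡ p
    o0 = trans (offset-top 0 (proj₁ on-top)) (trans (+-identityʳ _) (proj₂ on-top))
    o1 : offset j 1 ≡ suc p
    o1 = trans (offset-top 1 (proj₁ on-top)) (trans (+-comm _ 1) (cong suc (proj₂ on-top)))

  vertical-traversed : ∀ c (i : Fin N) (jj : Fin M) → VCond M K c (toℕ i) (toℕ jj) →
    Traversed c (i , jj) (up (i , jj))
  vertical-traversed c i jj (inj₁ (low , inj₁ (i≡ , odd))) =
    traversed-upwards c i jj (shift-residue c (toℕ i) (trans i≡ (cong (_% K) (sym (+-identityʳ c))))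
                                            (offset-low-odd 1 (+K<⇒low low) odd))
  vertical-traversed c i jj (inj₁ (low , inj₂ (i≡ , even))) =
    traversed-upwards c i jj (shift-residue c (toℕ i) i≡ (offset-low-even 1 (+K<⇒low low) even))
  vertical-traversed c i jj (inj₂ (p , _ , j≡ , i≡)) =
    traversed-upwards c i jj (shift-residue c (toℕ i) (trans i≡ (cong (_% K) (+-assoc c p 1))) o1)
    where
    on-top = top-row⁻¹ j≡
    o1 : offset (toℕ jj) 1 ≡ p + 1
    o1 = trans (offset-top 1 (proj₁ on-top)) (cong (_+ 1) (proj₂ on-top))

  edge-traversed : ∀ c u v → WEdge N M K c u v → Traversed c u v
  edge-traversed c u v (inj₁ u→v) = step-traversed u v u→v
    where
    step-traversed : ∀ u v → WStep N M K c u v → Traversed c u v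
    step-traversed (i , jj) _ (inj₁ (hcond , refl)) = horizontal-traversed c i jj hcond
    step-traversed (i , jj) _ (inj₂ (vcond , refl)) = vertical-traversed c i jj vcond
  edge-traversed c u v (inj₂ v→u) with edge-traversed c v u (inj₁ v→u)
  ... | t , inj₁ (here , after) = t , inj₂ (here , after)
  ... | t , inj₂ (here , after) = t , inj₁ (here , after)

  -- The two offsets of a row are incongruent modulo K, since they differ by one and K ≥ 2.
  adjacent-incongruent : ∀ c {x y} → y ≡ suc x → (c + x) % K ≢ (c + y) % K
  adjacent-incongruent c {x} refl e = suc-%-≢ k' (c + x) (trans (cong (_% K) (sym (+-suc c x))) (sym e))

  offsets-incongruent : ∀ c j → (c + offset j 0) % K ≢ (c + offset j 1) % K
  offsets-incongruent c j e with offsets-adjacent j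
  ... | inj₁ o1≡ = adjacent-incongruent c o1≡ e
  ... | inj₂ o0≡ = adjacent-incongruent c o0≡ (sym e)

  offset-residue-injective : ∀ c j {b b'} → b < 2 → b' < 2 →
    (c + offset j b) % K ≡ (c + offset j b') % K → b ≡ b'
  offset-residue-injective c j {0} {0} _ _ _ = refl
  offset-residue-injective c j {0} {1} _ _ e = ⊥-elim (offsets-incongruent c j e)
  offset-residue-injective c j {1} {0} _ _ e = ⊥-elim (offsets-incongruent c j (sym e))
  offset-residue-injective c j {1} {1} _ _ _ = refl
  offset-residue-injective c j {suc (suc _)} (s≤s (s≤s ())) _ _
  offset-residue-injective c j {_} {suc (suc _)} _ (s≤s (s≤s ())) _

  pass-injective : ∀ x {q q'} → q < n → q' < n → (x + K * q) % N ≡ (x + K * q') % N → q ≡ q'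
  pass-injective x {q} {q'} q<n q'<n e = begin
      q         ≡⟨ m<n⇒m%n≡m q<n ⟨
      q % n     ≡⟨ *-%-cancelʳ n K q q' qK≡q'K ⟩
      q' % n    ≡⟨ m<n⇒m%n≡m q'<n ⟩
      q'        ∎
    where
    open ≡-Reasoning
    qK≡q'K : (q * K) % N ≡ (q' * K) % N
    qK≡q'K = trans (cong (_% N) (*-comm q K))
                   (trans (%-cancel-+ˡ _ x (K * q) (K * q') e) (cong (_% N) (*-comm K q')))

  -- Within one period a vertex determines its row, then its place b in the row, then
  -- its pass.
  vertex-row : ∀ c q j b q' j' b' → j < M → j' < M →
    vertex c (q , j , b) ≡ vertex c (q' , j' , b') → j ≡ j'
  vertex-row c q j b q' j' b' j<M j'<M e =
    trans (sym (toℕ-row j<M)) (trans (cong (λ v → toℕ (proj₂ v)) e) (toℕ-row j'<M))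

  vertex-place : ∀ c q j b q' b' → b < 2 → b' < 2 →
    vertex c (q , j , b) ≡ vertex c (q' , j , b') → b ≡ b'
  vertex-place c q j b q' b' b<2 b'<2 e = offset-residue-injective c j b<2 b'<2
    (trans (sym (column-residue c q j b)) (trans (cong (λ v → toℕ (proj₁ v) % K) e) (column-residue c q' j b')))

  vertex-pass : ∀ c q j b q' → q < n → q' < n →
    vertex c (q , j , b) ≡ vertex c (q' , j , b) → q ≡ q'
  vertex-pass c q j b q' q<n q'<n e = pass-injective (c + offset j b) q<n q'<n
    (trans (sym (toℕ-mod (column c (q , j , b))))
           (trans (cong (λ v → toℕ (proj₁ v)) e) (toℕ-mod (column c (q' , j , b)))))

  vertex-injective : ∀ c {q j b q' j' b'} → Valid (q , j , b) → Valid (q' , j' , b') → q < n → q' < n →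
    vertex c (q , j , b) ≡ vertex c (q' , j' , b') → (q , j , b) ≡ (q' , j' , b')
  vertex-injective c {q} {j} {b} {q'} {j'} {b'} (j<M , b<2) (j'<M , b'<2) q<n q'<n e
    with vertex-row c q j b q' j' b' j<M j'<M e
  ... | refl with vertex-place c q j b q' b' b<2 b'<2 e
  ...   | refl = cong (_, j , b) (vertex-pass c q j b q' q<n q'<n e)

  pass<n : ∀ q j b → index q j b < L → q < n
  pass<n q j b h = ≰⇒> (λ n≤q → <⇒≱ h (≤-trans (*-monoˡ-≤ (2 * M) n≤q) (m≤n+m (q * (2 * M)) (b + j * 2))))

  walk-injective : ∀ c {t t' : Fin L} → walk c t ≡ walk c t' → t ≡ t'
  walk-injective c {t} {t'} e = toℕ-injective (begin
      toℕ t                    ≡⟨ index-decode (toℕ t) ⟩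
      index′ (decode (toℕ t))  ≡⟨ cong index′ decode≡ ⟩
      index′ (decode (toℕ t')) ≡⟨ index-decode (toℕ t') ⟨
      toℕ t'                   ∎)
    where
    open ≡-Reasoning
    index′ : Triple → ℕ
    index′ (q , j , b) = index q j b
    pass< : ∀ (t : Fin L) → proj₁ (decode (toℕ t)) < n
    pass< t = let (q , j , b) = decode (toℕ t) in
              pass<n q j b (subst (_< L) (index-decode (toℕ t)) (toℕ<n t))
    decode≡ : decode (toℕ t) ≡ decode (toℕ t')
    decode≡ = vertex-injective c (decode-valid (toℕ t)) (decode-valid (toℕ t')) (pass< t) (pass< t') e

  walk-traversal : 3 ≤ M → ∀ c → IsTraversal (WEdge N M K c) L (walk c)
  walk-traversal 3≤M c = 3≤L , walk-injective c , walk-step c , edge-traversed c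
    where
    3≤L : 3 ≤ L
    3≤L = ≤-trans 3≤M (≤-trans (m≤m+n M (M + 0)) (m≤m+n (2 * M) (n' * (2 * M))))

  visit-advance : ∀ c q j e b → b < 2 →
    visit c (index q j 0 + (b + e * 2)) ≡ vertex c (q + (j + e) / M , (j + e) % M , b)
  visit-advance c q j e b b<2 =
    cong (vertex c) (trans (cong decode index≡)
                           (decode-index (q + (j + e) / M) ((j + e) % M) b (m%n<n (j + e) M , b<2)))
    where
    regroup₁ : ∀ j e q b P → (0 + j * 2) + q * P + (b + e * 2) ≡ b + (j + e) * 2 + q * P
    regroup₁ = solve-∀
    regroup₂ : ∀ b r a M q → b + (r + a * M) * 2 + q * (2 * M) ≡ (b + r * 2) + (q + a) * (2 * M)
    regroup₂ = solve-∀
    index≡ : index q j 0 + (b + e * 2) ≡ index (q + (j + e) / M) ((j + e) % M) b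
    index≡ = trans (regroup₁ j e q b (2 * M))
                   (trans (cong (λ z → b + z * 2 + q * (2 * M)) (m≡m%n+[m/n]*n (j + e) M))
                          (regroup₂ b ((j + e) % M) ((j + e) / M) M q))

  row-advance : ∀ j e → j < M → ((j + e) % M) mod M ≡ shift (j mod M) e
  row-advance j e j<M = toℕ-injective (begin
      toℕ (((j + e) % M) mod M)     ≡⟨ toℕ-mod ((j + e) % M) ⟩
      (j + e) % M % M               ≡⟨ m%n%n≡m%n (j + e) M ⟩
      (j + e) % M                   ≡⟨ cong (λ z → (z + e) % M) (toℕ-row j<M) ⟨
      (toℕ (j mod M) + e) % M       ≡⟨ toℕ-shift (j mod M) e ⟨
      toℕ (shift (j mod M) e)       ∎)
    where open ≡-Reasoning

  -- The sets S_ℓ, for a set S' of rows: S_ℓ consists of the first vertices of the rows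
  -- in S' along the traversal of C_(ℓ+1), i.e. of the vertices (i , j) with j ∈ S' and
  -- i ≡ ℓ + 1 + offset j 0 (mod K).
  module Parts (S' : Fin M → Bool) where

    private
      false≢true : false ≢ true
      false≢true ()

    S : ℕ → Vtx N M → Bool
    S ℓ (i , jj) = S' jj ∧ does (toℕ i % K ≟ (suc ℓ + offset (toℕ jj) 0) % K)

    S-true : ∀ ℓ i jj → S ℓ (i , jj) ≡ true → S' jj ≡ true × Cong K (toℕ i) (suc ℓ + offset (toℕ jj) 0)
    S-true ℓ i jj h =
      let (S'j , test) = ∧-true h in S'j , does-true (toℕ i % K ≟ (suc ℓ + offset (toℕ jj) 0) % K) test


    S-first : ∀ ℓ q j → j < M → S ℓ (vertex (suc ℓ) (q , j , 0)) ≡ S' (j mod M)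
    S-first ℓ q j j<M = trans (cong (S' (j mod M) ∧_) (dec-true (_ ≟ _) residue≡)) (∧-identityʳ _)
      where
      residue≡ : toℕ (proj₁ (vertex (suc ℓ) (q , j , 0))) % K ≡ (suc ℓ + offset (toℕ (j mod M)) 0) % K
      residue≡ = trans (column-residue (suc ℓ) q j 0)
                       (cong (λ z → (suc ℓ + offset z 0) % K) (sym (toℕ-row j<M)))

    S-second : ∀ ℓ q j → j < M → S ℓ (vertex (suc ℓ) (q , j , 1)) ≡ false
    S-second ℓ q j j<M = trans (cong (S' (j mod M) ∧_) (dec-false (_ ≟ _) residue≢)) (∧-zeroʳ _)
      where
      residue≢ : toℕ (proj₁ (vertex (suc ℓ) (q , j , 1))) % K ≢ (suc ℓ + offset (toℕ (j mod M)) 0) % K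
      residue≢ e = offsets-incongruent (suc ℓ) j
        (sym (trans (sym (column-residue (suc ℓ) q j 1))
                    (trans e (cong (λ z → (suc ℓ + offset z 0) % K) (toℕ-row j<M)))))

    S-on-cycle : ∀ ℓ v → S ℓ v ≡ true → ∃ λ t → walk (suc ℓ) t ≡ v
    S-on-cycle ℓ (i , jj) h =
      let (q , u≡) = occurs (suc ℓ) 0 i jj (proj₂ (S-true ℓ i jj h))
          (t , here , _) = occurs-step (suc ℓ) q (toℕ jj) 0 (toℕ<n jj , z<s)
      in t , trans here u≡

    module _ (ℓ : ℕ) (t : Fin L) (q j : ℕ) (j<M : j < M) (t≡ : toℕ t ≡ index q j 0) where

      walk-ahead : ∀ e b → b < 2 →
        walk (suc ℓ) (shift t (b + e * 2)) ≡ vertex (suc ℓ) (q + (j + e) / M , (j + e) % M , b)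
      walk-ahead e b b<2 = trans (walk-shift (suc ℓ) t (b + e * 2))
        (trans (cong (λ z → visit (suc ℓ) (z + (b + e * 2))) t≡) (visit-advance (suc ℓ) q j e b b<2))

      S-ahead-first : ∀ e → S ℓ (walk (suc ℓ) (shift t (e * 2))) ≡ S' (shift (j mod M) e)
      S-ahead-first e = begin
          S ℓ (walk (suc ℓ) (shift t (e * 2)))                      ≡⟨ cong (S ℓ) (walk-ahead e 0 z<s) ⟩
          S ℓ (vertex (suc ℓ) (q + (j + e) / M , (j + e) % M , 0))
            ≡⟨ S-first ℓ (q + (j + e) / M) ((j + e) % M) (m%n<n (j + e) M) ⟩
          S' (((j + e) % M) mod M)                                  ≡⟨ cong S' (row-advance j e j<M) ⟩
          S' (shift (j mod M) e)                                    ∎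
        where open ≡-Reasoning

      S-ahead-second : ∀ e → S ℓ (walk (suc ℓ) (shift t (1 + e * 2))) ≡ false
      S-ahead-second e = trans (cong (S ℓ) (walk-ahead e 1 (s≤s z<s)))
                               (S-second ℓ (q + (j + e) / M) ((j + e) % M) (m%n<n (j + e) M))

    S-at-first : ∀ ℓ (t : Fin L) → S ℓ (walk (suc ℓ) t) ≡ true →
      ∃ λ q → ∃ λ j → j < M × toℕ t ≡ index q j 0 × S' (j mod M) ≡ true
    S-at-first ℓ t St = by-b q j b (decode-valid (toℕ t)) (index-decode (toℕ t))
      where
      q = proj₁ (decode (toℕ t))
      j = proj₁ (proj₂ (decode (toℕ t)))
      b = proj₂ (proj₂ (decode (toℕ t)))
      by-b : ∀ q j b → Valid (q , j , b) → toℕ t ≡ index q j b →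
        ∃ λ q → ∃ λ j → j < M × toℕ t ≡ index q j 0 × S' (j mod M) ≡ true
      by-b q j b (j<M , b<2) t≡ with b | b<2
      ... | 0 | _ = q , j , j<M , t≡ , trans (sym (S-first ℓ q j j<M)) (trans (cong (S ℓ) vertex≡) St)
        where
        vertex≡ : vertex (suc ℓ) (q , j , 0) ≡ walk (suc ℓ) t
        vertex≡ = sym (trans (cong (visit (suc ℓ)) t≡) (cong (vertex (suc ℓ)) (decode-index q j 0 (j<M , z<s))))
      ... | 1 | _ = ⊥-elim (false≢true (trans (sym (S-second ℓ q j j<M)) (trans (cong (S ℓ) vertex≡) St)))
        where
        vertex≡ : vertex (suc ℓ) (q , j , 1) ≡ walk (suc ℓ) t
        vertex≡ = sym (trans (cong (visit (suc ℓ)) t≡) (cong (vertex (suc ℓ)) (decode-index q j 1 (j<M , s≤s z<s))))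
      ... | suc (suc _) | s≤s (s≤s ())

    S-distance-regular : ∀ ℓ → DistReg M id S' → DistReg L (walk (suc ℓ)) (S ℓ)
    S-distance-regular ℓ (d , 1≤d , regular) = d * 2 , ≤-trans 1≤d (m≤m*n d 2) , λ t St →
      let (q , j , j<M , t≡ , S'j) = S-at-first ℓ t St
          (S'-next , S'-none-between) = regular (j mod M) S'j
      in trans (S-ahead-first ℓ t q j j<M t≡ d) S'-next ,
         none-between t q j j<M t≡ S'-none-between
      where
      none-between : ∀ (t : Fin L) q j → j < M → toℕ t ≡ index q j 0 →
        (∀ e → 1 ≤ e → e < d → ¬ (S' (shift (j mod M) e) ≡ true)) →
        ∀ e → 1 ≤ e → e < d * 2 → ¬ (S ℓ (walk (suc ℓ) (shift t e)) ≡ true)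
      none-between t q j j<M t≡ none' e 1≤e e<2d = by-parity (e % 2) (m%n<n e 2) (m≡m%n+[m/n]*n e 2)
        where
        by-parity : ∀ b → b < 2 → e ≡ b + (e / 2) * 2 → ¬ (S ℓ (walk (suc ℓ) (shift t e)) ≡ true)
        S-at : ∀ {e'} → e ≡ e' → S ℓ (walk (suc ℓ) (shift t e)) ≡ S ℓ (walk (suc ℓ) (shift t e'))
        S-at e≡ = cong (λ z → S ℓ (walk (suc ℓ) (shift t z))) e≡
        by-parity 0 _ e≡ Se = none' (e / 2) 1≤e/2 e/2<d
          (trans (sym (S-ahead-first ℓ t q j j<M t≡ (e / 2))) (trans (sym (S-at e≡)) Se))
          where
          1≤e/2 : 1 ≤ e / 2
          1≤e/2 = n≢0⇒n>0 (λ e/2≡0 → <⇒≱ 1≤e (≤-reflexive (trans e≡ (cong (_* 2) e/2≡0))))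
          e/2<d : e / 2 < d
          e/2<d = *-cancelʳ-< 2 (e / 2) d (subst (_< d * 2) e≡ e<2d)
        by-parity 1 _ e≡ Se = false≢true
          (trans (sym (S-ahead-second ℓ t q j j<M t≡ (e / 2))) (trans (sym (S-at e≡)) Se))
        by-parity (suc (suc _)) (s≤s (s≤s ())) _

    -- The S_ℓ, ℓ < K, partition the vertices (i , j) with j ∈ S': the residue of i modulo
    -- K determines ℓ.
    S-partition : ∀ (v : Vtx N M) → S' (proj₂ v) ≡ true →
      ∃ λ (ℓ : Fin K) → S (toℕ ℓ) v ≡ true × (∀ ℓ' → S (toℕ ℓ') v ≡ true → ℓ' ≡ ℓ)
    S-partition (i , jj) S'j = ℓ , (cong₂ _∧_ S'j (dec-true (_ ≟ _) (sym ℓ-solves))) , unique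
      where
      ov = offset (toℕ jj) 0
      ℓ-in : ∀ ℓ → (suc ℓ + ov) % K ≡ (ℓ + suc ov) % K
      ℓ-in ℓ = cong (_% K) (sym (+-suc ℓ ov))
      solution = %-solve (suc k') (toℕ i) (suc ov)
      ℓ = proj₁ solution
      ℓ-solves : (suc (toℕ ℓ) + ov) % K ≡ toℕ i % K
      ℓ-solves = trans (ℓ-in (toℕ ℓ)) (proj₂ solution)
      unique : ∀ ℓ' → S (toℕ ℓ') (i , jj) ≡ true → ℓ' ≡ ℓ
      unique ℓ' h = %-solve-unique (suc k') (suc ov) ℓ' ℓ
        (trans (sym (ℓ-in (toℕ ℓ')))
               (trans (sym (proj₂ (S-true (toℕ ℓ') i jj h))) (sym (proj₂ solution))))

    -- Translating by ℓ columns maps S_0 onto S_ℓ, so all S_ℓ have the same size.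
    translate : ℕ → Vtx N M → Vtx N M
    translate ℓ (i , jj) = (shift i ℓ , jj)

    S-translate : ∀ ℓ v → S ℓ (translate ℓ v) ≡ S 0 v
    S-translate ℓ (i , jj) = cong (S' jj ∧_) (does-⇔ (mk⇔ forth back) (_ ≟ _) (_ ≟ _))
      where
      I = toℕ i
      ov = offset (toℕ jj) 0
      shifted : toℕ (shift i ℓ) % K ≡ (I + ℓ) % K
      shifted = trans (cong (_% K) (toℕ-shift i ℓ)) (m∣n⇒o%n%m≡o%m K N (I + ℓ) (divides n refl))
      regroup : (suc ℓ + ov) % K ≡ ((1 + ov) + ℓ) % K
      regroup = cong (_% K) (cong suc (+-comm ℓ ov))
      forth : toℕ (shift i ℓ) % K ≡ (suc ℓ + ov) % K → I % K ≡ (1 + ov) % K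
      forth e = %-cancel-+ʳ (suc k') I (1 + ov) ℓ (trans (sym shifted) (trans e regroup))
      back : I % K ≡ (1 + ov) % K → toℕ (shift i ℓ) % K ≡ (suc ℓ + ov) % K
      back e = trans shifted (trans (%-cong-+ʳ K I (1 + ov) ℓ e) (sym regroup))

    S-card : ∀ ℓ → ℓ < K → card (S ℓ) ≡ card (S 0)
    S-card ℓ ℓ<K =
      trans (card-∘-bijection (S ℓ) (translate ℓ) (translate (N ∸ ℓ)) there-and-back back-and-there)
            (card-cong _ _ (S-translate ℓ))
      where
      ℓ≤N : ℓ ≤ N
      ℓ≤N = ≤-trans (<⇒≤ ℓ<K) (m≤n*m K n)
      there-and-back : ∀ v → translate (N ∸ ℓ) (translate ℓ v) ≡ v
      there-and-back (i , jj) = cong (_, jj) (shift-shift i ℓ (N ∸ ℓ) (m+[n∸m]≡n ℓ≤N))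
      back-and-there : ∀ v → translate ℓ (translate (N ∸ ℓ) v) ≡ v
      back-and-there (i , jj) = cong (_, jj) (shift-shift i (N ∸ ℓ) ℓ (m∸n+n≡m ℓ≤N))

proposition6 : (N M k s : ℕ) → 2 ≤ k → 3 ≤ N → 3 ≤ M → k ∣ N → M ≡ 2 * s + k →
    (S' : Fin M → Bool) → DistReg M id S' →
    Σ (Fin k → Vtx N M → Bool) λ S →
      (∀ ℓ ℓ' → card (S ℓ) ≡ card (S ℓ'))
      × (∀ ℓ v → S ℓ v ≡ true → S' (proj₂ v) ≡ true)
      × (∀ v → S' (proj₂ v) ≡ true →
           ∃ λ ℓ → S ℓ v ≡ true × (∀ ℓ' → S ℓ' v ≡ true → ℓ' ≡ ℓ))
      × (∀ ℓ → ∃ λ L → Σ (Fin L → Vtx N M) λ f →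
           IsTraversal (WEdge N M k (suc (toℕ ℓ))) L f
           × (∀ v → S ℓ v ≡ true → ∃ λ t → f t ≡ v)
           × DistReg L f (S ℓ))
-- The degenerate parameter values (M = 0, k < 2, N = 0) contradict the hypotheses; in
-- the remaining case k = K, N = n·K, and everything is provided by Wiggle and Parts.
proposition6 N zero k s _ _ () _ _ _ _
proposition6 N (suc M') zero s () _ _ _ _ _ _
proposition6 N (suc M') (suc zero) s (s≤s ()) _ _ _ _ _ _
proposition6 N (suc M') (suc (suc k')) s _ (s≤s _) _ (divides zero ()) _ _ _
proposition6 N (suc M') (suc (suc k')) s _ _ 3≤M (divides (suc n') refl) M≡ S' regular =
  (λ ℓ → S (toℕ ℓ)) ,
  (λ ℓ ℓ' → trans (S-card (toℕ ℓ) (toℕ<n ℓ)) (sym (S-card (toℕ ℓ') (toℕ<n ℓ')))) ,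
  (λ ℓ v h → proj₁ (S-true (toℕ ℓ) (proj₁ v) (proj₂ v) h)) ,
  S-partition ,
  (λ ℓ → L , walk (suc (toℕ ℓ)) , walk-traversal 3≤M (suc (toℕ ℓ)) ,
         S-on-cycle (toℕ ℓ) , S-distance-regular (toℕ ℓ) regular)
  where
  open Wiggle k' s n' M≡
  open Parts S'
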